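{- Let $n\ge 2$ and let $\mathcal{S}_n$ be the set of integer solutions, identified up to permutation of coordinates, of $\left(\sum_i x_i\right)^2-\sum_i x_i-4\sum_{1\le i<j\le n}x_ix_j=0$, viewed as a graph in which two elements are adjacent if (for suitable orderings) they differ in exactly one coordinate. For $\mathbf{a}\in\mathcal{S}_n$ define its height as $h(\mathbf{a})=\left|1+\sum_i a_i\right|$. Then for every vertex of $\mathcal{S}_n$, at most one of its neighbors has smaller height than it. Moreover, any two adjacent vertices have different heights.
   Context: Equivalently, the neighbors of $\mathbf{a}$ are the tuples obtained by replacing some coordinate $a_k$ by $2\sum_{i\ne k}a_i+1-a_k$ (the other root of the equation viewed as a quadratic in $x_k$). -}

module Defs where

open import Data.Nat using (ℕ; zero; suc)
open import Data.Fin using (Fin; zero; suc)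
open import Data.Fin.Permutation using (Permutation′; _⟨$⟩ʳ_)
open import Data.Integer using (ℤ; _+_; _-_; _*_; ∣_∣; 0ℤ; 1ℤ)
open import Data.Product using (Σ; _×_)
open import Relation.Binary.PropositionalEquality using (_≡_; _≢_)

Tuple : ℕ → Set
Tuple n = Fin n → ℤ

sumT : ∀ {n} → Tuple n → ℤ
sumT {zero}  x = 0ℤ
sumT {suc n} x = x zero + sumT (λ i → x (suc i))

pairSum : ∀ {n} → Tuple n → ℤ
pairSum {zero}  x = 0ℤ
pairSum {suc n} x = x zero * sumT (λ i → x (suc i)) + pairSum (λ i → x (suc i))

IsSolution : ∀ {n} → Tuple n → Set
IsSolution x = (sumT x * sumT x - sumT x) - (Data.Integer.+ 4) * pairSum x ≡ 0ℤ

height : ∀ {n} → Tuple n → ℕ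
height a = ∣ 1ℤ + sumT a ∣

PermEquiv : ∀ {n} → Tuple n → Tuple n → Set
PermEquiv {n} a b = Σ (Permutation′ n) λ π → ∀ i → a (π ⟨$⟩ʳ i) ≡ b i

DifferInExactlyOne : ∀ {n} → Tuple n → Tuple n → Set
DifferInExactlyOne {n} x y =
  Σ (Fin n) λ k → (x k ≢ y k) × (∀ i → i ≢ k → x i ≡ y i)

Adjacent : ∀ {n} → Tuple n → Tuple n → Set
Adjacent {n} a b =
  Σ (Permutation′ n) λ π → Σ (Permutation′ n) λ σ →
    DifferInExactlyOne (λ i → a (π ⟨$⟩ʳ i)) (λ i → b (σ ⟨$⟩ʳ i))

-- Eliminating the cross terms, the equation reads 2 Σ xᵢ² = S² + S with S = Σ xᵢ. As a quadratic
-- in one coordinate u, the others summing to T, it is u² − (2T + 1)u + c = 0, so by Vieta every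
-- neighbour of a replaces some aₚ by 2T + 1 − aₚ, changing the coordinate sum from S to 3S + 1 − 4aₚ.
-- The heights |1 + S| and |3S + 2 − 4aₚ| differ because 1 + S ± (3S + 2 − 4aₚ) are both odd.
-- A descent at p forces 16aₚ² ≥ (2S + 1)² + 2, so descents at two different coordinates would give
-- 16 Σ aᵢ² ≥ 2(2S + 1)² + 4 = 8(S² + S) + 6 = 16 Σ aᵢ² + 6. Hence all descending neighbours arise
-- from the same coordinate and coincide up to order.
module Submission where

open import Defs
open import Data.Nat using (ℕ; _≤_; _<_)
open import Data.Product using (_×_; Σ; _,_)

import Data.Nat as ℕ
import Data.Nat.Properties as ℕ
open import Data.Integer as ℤ using (ℤ; +_; -[1+_]; _+_; _-_; _*_; 0ℤ; 1ℤ; ∣_∣; +≤+)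
import Data.Integer.Properties as ℤ
open import Data.Integer.Tactic.RingSolver using (solve-∀)
open import Algebra.Properties.AbelianGroup ℤ.+-0-abelianGroup using () renaming (∙-cancelˡ to +-cancelˡ)
open import Algebra.Properties.CommutativeMonoid.Sum ℤ.+-0-commutativeMonoid
  using (sum; sum-remove; sum-permute; sum-cong-≗)
open import Data.Fin using (Fin; suc; punchIn; punchOut; _≟_)
open import Data.Fin.Properties using (punchInᵢ≢i; punchIn-punchOut)
open import Data.Fin.Permutation using (Permutation′; _⟨$⟩ʳ_; _⟨$⟩ˡ_; inverseˡ; inverseʳ; flip; _∘ₚ_; id)
open import Data.Vec.Functional using (removeAt; updateAt)
open import Data.Vec.Functional.Properties using (updateAt-updates; updateAt-minimal)
open import Data.Sum using (inj₁; inj₂)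
open import Data.Empty using (⊥; ⊥-elim)
open import Function using (_∘_)
open import Relation.Nullary using (yes; no)
open import Relation.Binary.PropositionalEquality
  using (_≡_; _≢_; refl; sym; trans; cong; cong₂; subst; subst₂; module ≡-Reasoning)

open ≡-Reasoning


i*i≡∣i∣*∣i∣ : ∀ i → i * i ≡ + (∣ i ∣ ℕ.* ∣ i ∣)
i*i≡∣i∣*∣i∣ (+ n)    = ℤ.+◃n≡+n _
i*i≡∣i∣*∣i∣ -[1+ n ] = ℤ.+◃n≡+n _

0≤i*i : ∀ i → 0ℤ ℤ.≤ i * i
0≤i*i i = subst (0ℤ ℤ.≤_) (sym (i*i≡∣i∣*∣i∣ i)) (+≤+ ℕ.z≤n)

0≤i*[i-1] : ∀ i → 0ℤ ℤ.≤ i * (i - 1ℤ)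
0≤i*[i-1] (+ 0)        = +≤+ ℕ.z≤n
0≤i*[i-1] (+ ℕ.suc n)  =
  subst (0ℤ ℤ.≤_) (sym (identity (+ n))) (ℤ.+-mono-≤ (0≤i*i (+ n)) (+≤+ ℕ.z≤n))
  where
  identity : ∀ q → (1ℤ + q) * ((1ℤ + q) - 1ℤ) ≡ q * q + q
  identity = solve-∀
0≤i*[i-1] -[1+ n ]     =
  subst (0ℤ ℤ.≤_) (sym (identity (+ ℕ.suc n))) (ℤ.+-mono-≤ (0≤i*i (+ ℕ.suc n)) (+≤+ ℕ.z≤n))
  where
  identity : ∀ q → (ℤ.- q) * ((ℤ.- q) - 1ℤ) ≡ q * q + q
  identity = solve-∀

∣i∣≡∣j∣⇒i*i≡j*j : ∀ i j → ∣ i ∣ ≡ ∣ j ∣ → i * i ≡ j * j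
∣i∣≡∣j∣⇒i*i≡j*j i j eq = begin
  i * i                 ≡⟨ i*i≡∣i∣*∣i∣ i ⟩
  + (∣ i ∣ ℕ.* ∣ i ∣)   ≡⟨ cong (λ m → + (m ℕ.* m)) eq ⟩
  + (∣ j ∣ ℕ.* ∣ j ∣)   ≡⟨ sym (i*i≡∣i∣*∣i∣ j) ⟩
  j * j                 ∎

∣i∣<∣j∣⇒1+i*i≤j*j : ∀ i j → ∣ i ∣ < ∣ j ∣ → 1ℤ + i * i ℤ.≤ j * j
∣i∣<∣j∣⇒1+i*i≤j*j i j lt =
  subst₂ ℤ._≤_ (cong (λ x → 1ℤ + x) (sym (i*i≡∣i∣*∣i∣ i))) (sym (i*i≡∣i∣*∣i∣ j)) (+≤+ (ℕ.*-mono-< lt lt))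

2i+1≢0 : ∀ i → + 2 * i + 1ℤ ≢ 0ℤ
2i+1≢0 i eq with ℕ.m*n≡1⇒m≡1 2 ∣ i ∣ (trans (sym (ℤ.abs-* (+ 2) i)) (cong ∣_∣ 2i≡-1))
  where
  identity : ∀ i → + 2 * i ≡ (+ 2 * i + 1ℤ) - 1ℤ
  identity = solve-∀
  2i≡-1 : + 2 * i ≡ -[1+ 0 ]
  2i≡-1 = trans (identity i) (cong (_- 1ℤ) eq)
... | ()

-- Both factors of α² − β² = (α − β)(α + β) are odd.
flipped-height≢ : ∀ S u → ∣ 1ℤ + S ∣ ≢ ∣ 1ℤ + (+ 3 * S + 1ℤ - + 4 * u) ∣
flipped-height≢ S u eq with ℤ.i*j≡0⇒i≡0∨j≡0 (+ 2 * (+ 2 * u - S - 1ℤ) + 1ℤ) product≡0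
  where
  identity : ∀ S u → let α = 1ℤ + S; β = 1ℤ + (+ 3 * S + 1ℤ - + 4 * u) in
    (+ 2 * (+ 2 * u - S - 1ℤ) + 1ℤ) * (+ 2 * (+ 2 * S - + 2 * u + 1ℤ) + 1ℤ) ≡ α * α - β * β
  identity = solve-∀
  product≡0 : (+ 2 * (+ 2 * u - S - 1ℤ) + 1ℤ) * (+ 2 * (+ 2 * S - + 2 * u + 1ℤ) + 1ℤ) ≡ 0ℤ
  product≡0 = trans (identity S u)
    (ℤ.i≡j⇒i-j≡0 (∣i∣≡∣j∣⇒i*i≡j*j (1ℤ + S) (1ℤ + (+ 3 * S + 1ℤ - + 4 * u)) eq))
... | inj₁ odd≡0 = 2i+1≢0 (+ 2 * u - S - 1ℤ) odd≡0
... | inj₂ odd≡0 = 2i+1≢0 (+ 2 * S - + 2 * u + 1ℤ) odd≡0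

descent-bound : ∀ S u → ∣ 1ℤ + (+ 3 * S + 1ℤ - + 4 * u) ∣ < ∣ 1ℤ + S ∣ →
  (+ 2 * S + 1ℤ) * (+ 2 * S + 1ℤ) + + 2 ℤ.≤ (+ 4 * u) * (+ 4 * u)
descent-bound S u lt = ℤ.0≤i-j⇒j≤i (subst (0ℤ ℤ.≤_) (sym (identity S u)) nonneg)
  where
  identity : ∀ S u →
    let α = 1ℤ + S; β = 1ℤ + (+ 3 * S + 1ℤ - + 4 * u); d = α - β; gap = α * α - (1ℤ + β * β) in
    (+ 4 * u) * (+ 4 * u) - ((+ 2 * S + 1ℤ) * (+ 2 * S + 1ℤ) + + 2)
      ≡ d * d + (d * (d - 1ℤ) + d * (d - 1ℤ)) + (gap + gap)
  identity = solve-∀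
  α = 1ℤ + S
  β = 1ℤ + (+ 3 * S + 1ℤ - + 4 * u)
  d = α - β
  gap = α * α - (1ℤ + β * β)
  gap≥0 : 0ℤ ℤ.≤ gap
  gap≥0 = ℤ.i≤j⇒0≤j-i (∣i∣<∣j∣⇒1+i*i≤j*j β α lt)
  nonneg : 0ℤ ℤ.≤ d * d + (d * (d - 1ℤ) + d * (d - 1ℤ)) + (gap + gap)
  nonneg = ℤ.+-mono-≤ (ℤ.+-mono-≤ (0≤i*i d) (ℤ.+-mono-≤ (0≤i*[i-1] d) (0≤i*[i-1] d)))
                      (ℤ.+-mono-≤ gap≥0 gap≥0)

two-descents-impossible : ∀ S Q u v →
  (+ 2 * S + 1ℤ) * (+ 2 * S + 1ℤ) + + 2 ℤ.≤ (+ 4 * u) * (+ 4 * u) →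
  (+ 2 * S + 1ℤ) * (+ 2 * S + 1ℤ) + + 2 ℤ.≤ (+ 4 * v) * (+ 4 * v) →
  u * u + v * v ℤ.≤ Q → Q + Q ≡ S * S + S → ⊥
two-descents-impossible S Q u v bound-u bound-v uv≤Q Q-eq with 0≤-6
  where
  identity : ∀ S Q u v →
    ((+ 4 * u) * (+ 4 * u) - ((+ 2 * S + 1ℤ) * (+ 2 * S + 1ℤ) + + 2))
    + ((+ 4 * v) * (+ 4 * v) - ((+ 2 * S + 1ℤ) * (+ 2 * S + 1ℤ) + + 2))
    + + 16 * (Q - (u * u + v * v))
    ≡ + 8 * ((Q + Q) - (S * S + S)) - + 6
  identity = solve-∀
  0≤-6 : 0ℤ ℤ.≤ -[1+ 5 ]
  0≤-6 = subst (0ℤ ℤ.≤_)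
    (trans (identity S Q u v) (cong (λ z → + 8 * z - + 6) (ℤ.i≡j⇒i-j≡0 Q-eq)))
    (ℤ.+-mono-≤ (ℤ.+-mono-≤ (ℤ.i≤j⇒0≤j-i bound-u) (ℤ.i≤j⇒0≤j-i bound-v))
                (ℤ.*-monoˡ-≤-nonNeg (+ 16) (ℤ.i≤j⇒0≤j-i uv≤Q)))
... | ()

other-root : ∀ s c u w → u * u + c ≡ s * u → w * w + c ≡ s * w → u ≢ w → w ≡ s - u
other-root s c u w root-u root-w u≢w with ℤ.i*j≡0⇒i≡0∨j≡0 (u - w) factored
  where
  factorise : ∀ s c u w → (u - w) * ((u + w) - s) ≡ ((u * u + c) - s * u) - ((w * w + c) - s * w)
  factorise = solve-∀
  factored : (u - w) * ((u + w) - s) ≡ 0ℤ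
  factored = trans (factorise s c u w) (cong₂ _-_ (ℤ.i≡j⇒i-j≡0 root-u) (ℤ.i≡j⇒i-j≡0 root-w))
... | inj₁ u-w≡0   = ⊥-elim (u≢w (ℤ.i-j≡0⇒i≡j u w u-w≡0))
... | inj₂ u+w-s≡0 = trans (cancel u w) (cong (λ t → t - u) (ℤ.i-j≡0⇒i≡j (u + w) s u+w-s≡0))
  where
  cancel : ∀ u w → w ≡ (u + w) - u
  cancel = solve-∀


squares : ∀ {n} → Tuple n → Tuple n
squares x i = x i * x i

sumT≡sum : ∀ {n} (x : Tuple n) → sumT x ≡ sum x
sumT≡sum {ℕ.zero}  x = refl
sumT≡sum {ℕ.suc n} x = cong (λ s → x Fin.zero + s) (sumT≡sum (x ∘ suc))

sumT-squared : ∀ {n} (x : Tuple n) → sumT x * sumT x ≡ sumT (squares x) + + 2 * pairSum x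
sumT-squared {ℕ.zero}  x = refl
sumT-squared {ℕ.suc n} x = begin
  (a + s) * (a + s)                        ≡⟨ expand a s ⟩
  a * a + (s * s + + 2 * (a * s))          ≡⟨ cong (λ t → a * a + (t + + 2 * (a * s))) (sumT-squared (x ∘ suc)) ⟩
  a * a + ((q + + 2 * p) + + 2 * (a * s))  ≡⟨ regroup a s q p ⟩
  (a * a + q) + + 2 * (a * s + p)          ∎
  where
  a = x Fin.zero
  s = sumT (x ∘ suc)
  q = sumT (squares (x ∘ suc))
  p = pairSum (x ∘ suc)
  expand : ∀ a s → (a + s) * (a + s) ≡ a * a + (s * s + + 2 * (a * s))
  expand = solve-∀
  regroup : ∀ a s q p → a * a + ((q + + 2 * p) + + 2 * (a * s)) ≡ (a * a + q) + + 2 * (a * s + p)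
  regroup = solve-∀

sum-reorder : ∀ {n} (x : Tuple n) (π : Permutation′ n) → sum (λ i → x (π ⟨$⟩ʳ i)) ≡ sum x
sum-reorder x π = sym (sum-permute x π)

-- The defining equation after eliminating the cross terms by (Σ xᵢ)² = Σ xᵢ² + 2 Σ_{i<j} xᵢxⱼ.
SquaresEquation : ∀ {n} → Tuple n → Set
SquaresEquation x = sum (squares x) + sum (squares x) ≡ sum x * sum x + sum x

solution⇒SquaresEquation : ∀ {n} (x : Tuple n) → IsSolution x → SquaresEquation x
solution⇒SquaresEquation x sol =
  subst₂ (λ q s → q + q ≡ s * s + s) (sumT≡sum (squares x)) (sumT≡sum x) (ℤ.i-j≡0⇒i≡j _ _ (begin
    (Q + Q) - (S * S + S)                               ≡⟨ identity S P Q ⟩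
    ((S * S - S) - + 4 * P) + + 2 * ((Q + + 2 * P) - S * S)
      ≡⟨ cong₂ (λ e f → e + + 2 * f) sol (ℤ.i≡j⇒i-j≡0 (sym (sumT-squared x))) ⟩
    0ℤ                                                  ∎))
  where
  S = sumT x
  P = pairSum x
  Q = sumT (squares x)
  identity : ∀ S P Q → (Q + Q) - (S * S + S) ≡ ((S * S - S) - + 4 * P) + + 2 * ((Q + + 2 * P) - S * S)
  identity = solve-∀

SquaresEquation-reorder : ∀ {n} (x : Tuple n) (π : Permutation′ n) →
  SquaresEquation x → SquaresEquation (λ i → x (π ⟨$⟩ʳ i))
SquaresEquation-reorder x π =
  subst₂ (λ q s → q + q ≡ s * s + s) (sym (sum-reorder (squares x) π)) (sym (sum-reorder x π))

coordinate-quadratic : ∀ {n} (y : Tuple n) (t T Q : ℤ) → SquaresEquation y →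
  sum y ≡ t + T → sum (squares y) ≡ t * t + Q →
  t * t + ((Q + Q) - (T * T + T)) ≡ (+ 2 * T + 1ℤ) * t
coordinate-quadratic y t T Q eq sum-y sum-y² = ℤ.i-j≡0⇒i≡j _ _ (begin
  (t * t + ((Q + Q) - (T * T + T))) - (+ 2 * T + 1ℤ) * t      ≡⟨ identity t T Q ⟩
  ((t * t + Q) + (t * t + Q)) - ((t + T) * (t + T) + (t + T))
    ≡⟨ cong₂ (λ q s → (q + q) - (s * s + s)) (sym sum-y²) (sym sum-y) ⟩
  (sum (squares y) + sum (squares y)) - (sum y * sum y + sum y) ≡⟨ ℤ.i≡j⇒i-j≡0 eq ⟩
  0ℤ                                                          ∎)
  where
  identity : ∀ t T Q → (t * t + ((Q + Q) - (T * T + T))) - (+ 2 * T + 1ℤ) * t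
                     ≡ ((t * t + Q) + (t * t + Q)) - ((t + T) * (t + T) + (t + T))
  identity = solve-∀

0≤sum : ∀ {n} (f : Tuple n) → (∀ i → 0ℤ ℤ.≤ f i) → 0ℤ ℤ.≤ sum f
0≤sum {ℕ.zero}  f nonneg = ℤ.≤-refl
0≤sum {ℕ.suc n} f nonneg = ℤ.+-mono-≤ (nonneg Fin.zero) (0≤sum (f ∘ suc) (nonneg ∘ suc))

≤sum : ∀ {n} (f : Tuple n) → (∀ i → 0ℤ ℤ.≤ f i) → ∀ i → f i ℤ.≤ sum f
≤sum {ℕ.suc n} f nonneg i = subst₂ ℤ._≤_ (ℤ.+-identityʳ (f i)) (sym (sum-remove f))
  (ℤ.+-monoʳ-≤ (f i) (0≤sum (removeAt f i) (nonneg ∘ punchIn i)))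

two≤sum : ∀ {n} (f : Tuple (ℕ.suc n)) → (∀ i → 0ℤ ℤ.≤ f i) → ∀ {p q} → p ≢ q → f p + f q ℤ.≤ sum f
two≤sum f nonneg {p} {q} p≢q = subst (f p + f q ℤ.≤_) (sym (sum-remove f))
  (ℤ.+-monoʳ-≤ (f p) (subst (λ j → f j ℤ.≤ sum (removeAt f p)) (punchIn-punchOut p≢q)
    (≤sum (removeAt f p) (nonneg ∘ punchIn p) (punchOut p≢q))))

⟨$⟩ʳ-injective : ∀ {n} (π : Permutation′ n) {i j} → π ⟨$⟩ʳ i ≡ π ⟨$⟩ʳ j → i ≡ j
⟨$⟩ʳ-injective π {i} {j} eq = begin
  i                       ≡⟨ sym (inverseˡ π) ⟩
  π ⟨$⟩ˡ (π ⟨$⟩ʳ i)       ≡⟨ cong (π ⟨$⟩ˡ_) eq ⟩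
  π ⟨$⟩ˡ (π ⟨$⟩ʳ j)       ≡⟨ inverseˡ π ⟩
  j                       ∎

sum-removeAt-reorder : ∀ {n} (x y : Tuple (ℕ.suc n)) (π : Permutation′ (ℕ.suc n)) (k : Fin (ℕ.suc n)) →
  (∀ i → i ≢ k → y i ≡ x (π ⟨$⟩ʳ i)) → sum y ≡ y k + sum (removeAt x (π ⟨$⟩ʳ k))
sum-removeAt-reorder x y π k agree = begin
  sum y                              ≡⟨ sum-remove y ⟩
  y k + sum (removeAt y k)
    ≡⟨ cong (λ s → y k + s) (sum-cong-≗ (λ i → agree (punchIn k i) (punchInᵢ≢i k i))) ⟩
  y k + sum (removeAt x′ k)          ≡⟨ cong (λ s → y k + s) (+-cancelˡ (x′ k) _ _ same-total) ⟩
  y k + sum (removeAt x (π ⟨$⟩ʳ k))  ∎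
  where
  x′ : Tuple _
  x′ i = x (π ⟨$⟩ʳ i)
  same-total : x′ k + sum (removeAt x′ k) ≡ x′ k + sum (removeAt x (π ⟨$⟩ʳ k))
  same-total = trans (sym (sum-remove x′)) (trans (sum-reorder x π) (sum-remove x))


PermEquiv-sym : ∀ {n} {a b : Tuple n} → PermEquiv a b → PermEquiv b a
PermEquiv-sym {a = a} (π , eq) = flip π , λ i → trans (sym (eq (π ⟨$⟩ˡ i))) (cong a (inverseʳ π))

PermEquiv-trans : ∀ {n} {a b c : Tuple n} → PermEquiv a b → PermEquiv b c → PermEquiv a c
PermEquiv-trans (π , a∘π≗b) (σ , b∘σ≗c) = σ ∘ₚ π , λ i → trans (a∘π≗b (σ ⟨$⟩ʳ i)) (b∘σ≗c i)

PermEquiv-sum : ∀ {n} {a b : Tuple n} → PermEquiv a b → sum a ≡ sum b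
PermEquiv-sum {a = a} (π , a∘π≗b) = trans (sym (sum-reorder a π)) (sum-cong-≗ a∘π≗b)

height≡∣1+sum∣ : ∀ {n} (a : Tuple n) → height a ≡ ∣ 1ℤ + sum a ∣
height≡∣1+sum∣ a = cong (λ s → ∣ 1ℤ + s ∣) (sumT≡sum a)

PermEquiv-height : ∀ {n} {a b : Tuple n} → PermEquiv a b → height a ≡ height b
PermEquiv-height {a = a} {b} a∼b = begin
  height a           ≡⟨ height≡∣1+sum∣ a ⟩
  ∣ 1ℤ + sum a ∣     ≡⟨ cong (λ s → ∣ 1ℤ + s ∣) (PermEquiv-sum a∼b) ⟩
  ∣ 1ℤ + sum b ∣     ≡⟨ sym (height≡∣1+sum∣ b) ⟩
  height b           ∎


-- Replaces aₚ by the other root of the equation viewed as a quadratic in xₚ.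
flipAt : ∀ {n} → Tuple (ℕ.suc n) → Fin (ℕ.suc n) → Tuple (ℕ.suc n)
flipAt a p = updateAt a p (λ aₚ → + 2 * sum (removeAt a p) + 1ℤ - aₚ)

height-flipAt : ∀ {n} (a : Tuple (ℕ.suc n)) p →
  height (flipAt a p) ≡ ∣ 1ℤ + (+ 3 * sum a + 1ℤ - + 4 * a p) ∣
height-flipAt a p = trans (height≡∣1+sum∣ (flipAt a p)) (cong (λ s → ∣ 1ℤ + s ∣) (begin
  sum (flipAt a p)
    ≡⟨ sum-removeAt-reorder a (flipAt a p) id p (λ i i≢p → updateAt-minimal i p a i≢p) ⟩
  flipAt a p p + T                    ≡⟨ cong (λ t → t + T) (updateAt-updates p a) ⟩
  (+ 2 * T + 1ℤ - a p) + T            ≡⟨ identity (a p) T ⟩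
  + 3 * (a p + T) + 1ℤ - + 4 * a p    ≡⟨ cong (λ s → + 3 * s + 1ℤ - + 4 * a p) (sym (sum-remove a)) ⟩
  + 3 * sum a + 1ℤ - + 4 * a p        ∎))
  where
  T = sum (removeAt a p)
  identity : ∀ u T → (+ 2 * T + 1ℤ - u) + T ≡ + 3 * (u + T) + 1ℤ - + 4 * u
  identity = solve-∀

flipAt-height≢ : ∀ {n} (a : Tuple (ℕ.suc n)) p → height a ≢ height (flipAt a p)
flipAt-height≢ a p eq =
  flipped-height≢ (sum a) (a p) (trans (sym (height≡∣1+sum∣ a)) (trans eq (height-flipAt a p)))

descending-flipAt-bound : ∀ {n} (a : Tuple (ℕ.suc n)) p → height (flipAt a p) < height a →
  (+ 2 * sum a + 1ℤ) * (+ 2 * sum a + 1ℤ) + + 2 ℤ.≤ (+ 4 * a p) * (+ 4 * a p)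
descending-flipAt-bound a p lt =
  descent-bound (sum a) (a p) (subst₂ _<_ (height-flipAt a p) (height≡∣1+sum∣ a) lt)

at-most-one-descending-flip : ∀ {n} (a : Tuple (ℕ.suc n)) → IsSolution a → ∀ {p q} → p ≢ q →
  height (flipAt a p) < height a → height (flipAt a q) < height a → ⊥
at-most-one-descending-flip a sol {p} {q} p≢q lt-p lt-q =
  two-descents-impossible (sum a) (sum (squares a)) (a p) (a q)
    (descending-flipAt-bound a p lt-p) (descending-flipAt-bound a q lt-q)
    (two≤sum (squares a) (0≤i*i ∘ a) p≢q) (solution⇒SquaresEquation a sol)

-- The old and the new value of the changed coordinate are two distinct roots of the same quadratic.
adjacent⇒PermEquiv-flipAt : ∀ {n} (a b : Tuple (ℕ.suc n)) → IsSolution a → IsSolution b → Adjacent a b →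
  Σ (Fin (ℕ.suc n)) λ p → PermEquiv b (flipAt a p)
adjacent⇒PermEquiv-flipAt a b sol-a sol-b (π , σ , k , u≢w , agree) =
  p , PermEquiv-trans {a = b} b∼flip∘π (PermEquiv-sym {a = flipAt a p} (π , λ _ → refl))
  where
  p = π ⟨$⟩ʳ k
  T = sum (removeAt a p)
  Q = sum (removeAt (squares a) p)
  b′ : Tuple _
  b′ i = b (σ ⟨$⟩ʳ i)
  agree′ : ∀ i → i ≢ k → b′ i ≡ a (π ⟨$⟩ʳ i)
  agree′ i i≢k = sym (agree i i≢k)
  root-a : a p * a p + ((Q + Q) - (T * T + T)) ≡ (+ 2 * T + 1ℤ) * a p
  root-a = coordinate-quadratic a (a p) T Q (solution⇒SquaresEquation a sol-a)
    (sum-remove {i = p} a) (sum-remove {i = p} (squares a))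
  root-b : b′ k * b′ k + ((Q + Q) - (T * T + T)) ≡ (+ 2 * T + 1ℤ) * b′ k
  root-b = coordinate-quadratic b′ (b′ k) T Q (SquaresEquation-reorder b σ (solution⇒SquaresEquation b sol-b))
    (sum-removeAt-reorder a b′ π k agree′)
    (sum-removeAt-reorder (squares a) (squares b′) π k (λ i i≢k → cong (λ z → z * z) (agree′ i i≢k)))
  b∼flip∘π : PermEquiv b (λ i → flipAt a p (π ⟨$⟩ʳ i))
  b∼flip∘π = σ , b′≗flip∘π
    where
    b′≗flip∘π : ∀ i → b′ i ≡ flipAt a p (π ⟨$⟩ʳ i)
    b′≗flip∘π i with i ≟ k
    ... | yes refl = trans (other-root (+ 2 * T + 1ℤ) ((Q + Q) - (T * T + T)) (a p) (b′ k) root-a root-b u≢w)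
                           (sym (updateAt-updates p a))
    ... | no i≢k   = trans (agree′ i i≢k) (sym (updateAt-minimal (π ⟨$⟩ʳ i) p a (i≢k ∘ ⟨$⟩ʳ-injective π)))


descending-neighbours-PermEquiv : ∀ {n} (a b c : Tuple (ℕ.suc n)) →
  IsSolution a → IsSolution b → IsSolution c → Adjacent a b → Adjacent a c →
  height b < height a → height c < height a → PermEquiv b c
descending-neighbours-PermEquiv a b c sol-a sol-b sol-c a~b a~c b<a c<a
  with adjacent⇒PermEquiv-flipAt a b sol-a sol-b a~b | adjacent⇒PermEquiv-flipAt a c sol-a sol-c a~c
... | p , b∼flip | q , c∼flip with p ≟ q
...   | yes refl = PermEquiv-trans {a = b} b∼flip (PermEquiv-sym {a = c} c∼flip)
...   | no p≢q   = ⊥-elim (at-most-one-descending-flip a sol-a p≢q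
                     (subst (_< height a) (PermEquiv-height {a = b} b∼flip) b<a)
                     (subst (_< height a) (PermEquiv-height {a = c} c∼flip) c<a))

adjacent⇒height≢ : ∀ {n} (a b : Tuple (ℕ.suc n)) → IsSolution a → IsSolution b → Adjacent a b →
  height a ≢ height b
adjacent⇒height≢ a b sol-a sol-b a~b with adjacent⇒PermEquiv-flipAt a b sol-a sol-b a~b
... | p , b∼flip = λ eq → flipAt-height≢ a p (trans eq (PermEquiv-height {a = b} b∼flip))

proposition4p3 : (n : ℕ) → 2 ≤ n →
    ((a b c : Tuple n) → IsSolution a → IsSolution b → IsSolution c →
      Adjacent a b → Adjacent a c →
      height b < height a → height c < height a → PermEquiv b c)
    × ((a b : Tuple n) → IsSolution a → IsSolution b →
      Adjacent a b → height a ≢ height b)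
proposition4p3 (ℕ.suc n) _ = descending-neighbours-PermEquiv , adjacent⇒height≢
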